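{- Let $f:\{a,c\}^\ast\to\{a,c\}^\ast$ be a special standard morphism such that the word $w=f(ac)=w_1w_2\cdots w_n$ has odd length $n$ and an even number $|w|_c$ of letters $c$. Let $\sigma:\{a,b,c\}^\ast\to\{a,b,c\}^\ast$ be the bisecting substitution associated with $f$, and assume that $\sigma$ is an authentic PWWF substitution. Let $g=\pi_{a\to b}(\sigma)$ and $\tilde g=\pi_{c\to a}(\sigma)$. Then $$M_g=M_{\tilde g}=\begin{pmatrix} 2|f(a)|_a+|f(a)|_c & |f(c)|_a-|f(a)|_a+\tfrac12\big(|f(c)|_c-|f(a)|_c\big)\\ |f(a)|_c & \tfrac12\big(|f(c)|_c-|f(a)|_c\big)\end{pmatrix}.$$ (Here $f$ coincides with the projection $\pi_{b\to c}(\sigma)$.)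
   Context: For a word $u$ and a letter $x$, $|u|_x$ is the number of occurrences of $x$ in $u$, and $|u|$ is the length of $u$. For distinct letters $x,y\in\{a,b,c\}$, $\pi_{x\to y}$ is the monoid morphism of $\{a,b,c\}^\ast$ replacing each $x$ by $y$ and fixing the other letters. Two-letter morphisms: for an ordered two-letter alphabet $(x,y)$ (we use $(a,c)$, $(b,c)$, $(a,b)$), define monoid endomorphisms of $\{x,y\}^\ast$ by $G: x\mapsto x,\ y\mapsto xy$; $\tilde G: x\mapsto x,\ y\mapsto yx$; $D: x\mapsto yx,\ y\mapsto y$; $\tilde D: x\mapsto xy,\ y\mapsto y$. Special standard morphisms are the elements of the monoid generated by $G,D$; special Sturmian morphisms are the elements of the monoid generated by $G,\tilde G,D,\tilde D$. Bisection: for $f$ and $w=f(ac)=w_1\cdots w_n$ as in the claim, define $v=v_1\cdots v_n\in\{a,b,c\}^\ast$ by $v_k=a$ if $w_k=a$; $v_k=b$ if $w_k=c$ and $|w_1\cdots w_k|_c$ is odd; $v_k=c$ if $w_k=c$ and $|w_1\cdots w_k|_c$ is even. With $m=|f(a)|$, the bisecting substitution is the monoid morphism $\sigma$ with $\sigma(a)=v_1\cdots v_m$, $\sigma(b)=v_{m+1}\cdots v_{2m}$, $\sigma(c)=v_{2m+1}\cdots v_n$. Projections of a substitution $\sigma$ of $\{a,b,c\}^\ast$: $\pi_{b\to c}(\sigma)$ on $\{a,c\}^\ast$ sends $a\mapsto\pi_{b\to c}(\sigma(a))$, $c\mapsto \pi_{b\to c}(\sigma(bc))$; $\pi_{a\to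 b}(\sigma)$ on $\{b,c\}^\ast$ sends $b\mapsto\pi_{a\to b}(\sigma(ab))$, $c\mapsto\pi_{a\to b}(\sigma(c))$; $\pi_{c\to a}(\sigma)$ on $\{a,b\}^\ast$ sends $a\mapsto \pi_{c\to a}(\sigma(ab))$, $b\mapsto\pi_{c\to a}(\sigma(c))$. $\sigma$ is an authentic PWWF substitution iff all three projections are special Sturmian morphisms. Incidence matrices: for a morphism $h$ of an ordered two-letter alphabet $(x,y)$, $M_h=\begin{pmatrix}|h(x)|_x & |h(y)|_x\\ |h(x)|_y & |h(y)|_y\end{pmatrix}$; thus $M_g$ uses the order $(b,c)$ and $M_{\tilde g}$ the order $(a,b)$. -}

module Defs where

open import Data.Nat using (ℕ; zero; suc; _+_; _*_)
open import Data.Bool using (Bool; true; false; not; if_then_else_)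
open import Data.List using (List; []; _∷_; _++_; length; take; drop; concatMap; map)
open import Data.Product using (_×_; _,_)
open import Relation.Binary.PropositionalEquality using (_≡_)

data L3 : Set where
  a b c : L3

Word3 : Set
Word3 = List L3

Subst3 : Set
Subst3 = L3 → Word3

data L2 : Set where
  x y : L2

Word2 : Set
Word2 = List L2

record Morph2 : Set where
  constructor mk
  field
    imgx : Word2
    imgy : Word2
open Morph2 public

img : Morph2 → L2 → Word2
img h x = imgx h
img h y = imgy h

apply : Morph2 → Word2 → Word2
apply h = concatMap (img h)

_∘ₘ_ : Morph2 → Morph2 → Morph2
φ ∘ₘ h = mk (apply φ (imgx h)) (apply φ (imgy h))

idₘ Gₘ G̃ₘ Dₘ D̃ₘ : Morph2
idₘ = mk (x ∷ []) (y ∷ [])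
Gₘ  = mk (x ∷ []) (x ∷ y ∷ [])
G̃ₘ  = mk (x ∷ []) (y ∷ x ∷ [])
Dₘ  = mk (y ∷ x ∷ []) (y ∷ [])
D̃ₘ  = mk (x ∷ y ∷ []) (y ∷ [])

data SpecialStandard : Morph2 → Set where
  std-id : SpecialStandard idₘ
  std-G  : ∀ {h} → SpecialStandard h → SpecialStandard (Gₘ ∘ₘ h)
  std-D  : ∀ {h} → SpecialStandard h → SpecialStandard (Dₘ ∘ₘ h)

data SpecialSturmian : Morph2 → Set where
  st-id : SpecialSturmian idₘ
  st-G  : ∀ {h} → SpecialSturmian h → SpecialSturmian (Gₘ ∘ₘ h)
  st-G̃  : ∀ {h} → SpecialSturmian h → SpecialSturmian (G̃ₘ ∘ₘ h)
  st-D  : ∀ {h} → SpecialSturmian h → SpecialSturmian (Dₘ ∘ₘ h)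
  st-D̃  : ∀ {h} → SpecialSturmian h → SpecialSturmian (D̃ₘ ∘ₘ h)

count2 : L2 → Word2 → ℕ
count2 _ [] = 0
count2 x (x ∷ w) = suc (count2 x w)
count2 x (y ∷ w) = count2 x w
count2 y (x ∷ w) = count2 y w
count2 y (y ∷ w) = suc (count2 y w)

-- Ordered two-letter alphabets as sub-alphabets of {a,b,c}
-- (a,c): x = a, y = c ;  (b,c): x = b, y = c ;  (a,b): x = a, y = b

embAC : L2 → L3
embAC x = a
embAC y = c

-- projections of letters followed by identification with the ordered
-- two-letter alphabet
-- π_{b→c} : {a,b,c} → {a,c}  ≅ (x,y)
pBC : L3 → L2
pBC a = x
pBC b = y
pBC c = y

pAB : L3 → L2
pAB a = x
pAB b = x
pAB c = y

pCA : L3 → L2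
pCA a = x
pCA b = y
pCA c = x

projBC : Subst3 → Morph2
projBC σ = mk (map pBC (σ a)) (map pBC (σ b ++ σ c))

projAB : Subst3 → Morph2
projAB σ = mk (map pAB (σ a ++ σ b)) (map pAB (σ c))

projCA : Subst3 → Morph2
projCA σ = mk (map pCA (σ a ++ σ b)) (map pCA (σ c))

AuthenticPWWF : Subst3 → Set
AuthenticPWWF σ =
  SpecialSturmian (projBC σ) × SpecialSturmian (projAB σ) × SpecialSturmian (projCA σ)

-- bisWord p w : p = true iff the number of c's read so far is odd.
-- An occurrence of c making the running count odd becomes b, even becomes c.
bisWord : Bool → Word2 → Word3
bisWord p [] = []
bisWord p (x ∷ w) = a ∷ bisWord p w
bisWord false (y ∷ w) = b ∷ bisWord true w
bisWord true  (y ∷ w) = c ∷ bisWord false w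

bisect : Morph2 → Subst3
bisect f a = take m v
  where m = length (imgx f)
        v = bisWord false (imgx f ++ imgy f)
bisect f b = take m (drop m v)
  where m = length (imgx f)
        v = bisWord false (imgx f ++ imgy f)
bisect f c = drop (m + m) v
  where m = length (imgx f)
        v = bisWord false (imgx f ++ imgy f)

record Mat2 : Set where
  constructor mat
  field
    m11 m12 m21 m22 : ℕ
open Mat2 public

incidence : Morph2 → Mat2
incidence h = mat (count2 x (imgx h)) (count2 x (imgy h))
                  (count2 y (imgx h)) (count2 y (imgy h))

data Even : ℕ → Set
data Odd : ℕ → Set
data Even where
  ev0 : Even 0
  evS : ∀ {n} → Odd n → Even (suc n)
data Odd where
  odS : ∀ {n} → Even n → Odd (suc n)

-- Apart from the identity, a special standard morphism f has f(a) a prefix of f(c) or f(c) a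
-- prefix of f(a).  If f(c) is not longer than f(a) (this includes f = id), σ(c) is empty, so
-- π_{a→b}(σ) erases c, which no special Sturmian morphism does.  Otherwise f(c) = f(a) t, so
-- σ(a)σ(b) is the bisection of f(a)f(a) and σ(c) a bisection of t.  Both words contain an even
-- number of c's, and a bisection of such a word contains as many b's as c's, half of them each;
-- so π_{a→b} and π_{c→a} count the same letters, and the matrix entries are read off.
module Submission where

open import Defs
open import Data.Nat using (ℕ)
open import Data.Integer using (ℤ; +_; _+_; _-_; _*_)
open import Data.List using (_++_; length)
open import Data.Product using (_×_)
open import Relation.Binary.PropositionalEquality using (_≡_)

import Data.Nat as ℕ
open import Data.Nat using (suc; _≤_)
import Data.Nat.Properties as ℕP
open import Data.Nat.Tactic.RingSolver using (solve-∀)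
open import Data.Integer using (_⊖_)
import Data.Integer.Properties as ℤP
open import Data.Bool using (Bool; true; false; not)
open import Data.List using (List; []; _∷_; take; drop; map; concat)
open import Data.List.Properties using (map-++; concat-++; ++-conicalˡ; length-++; length-++-≤ˡ; drop-drop; drop-all)
open import Data.Product using (_,_; ∃)
open import Data.Sum using (_⊎_; inj₁; inj₂)
open import Data.Empty using (⊥-elim)
open import Function using (_∘_)
open import Relation.Binary.PropositionalEquality using (_≢_; refl; sym; trans; cong; cong₂; subst; module ≡-Reasoning)

private
  variable
    A : Set

take-++-length : (xs ys : List A) {n : ℕ} → length xs ≡ n → take n (xs ++ ys) ≡ xs
take-++-length []       ys refl = refl
take-++-length (z ∷ xs) ys refl = cong (z ∷_) (take-++-length xs ys refl)

drop-++-length : (xs ys : List A) {n : ℕ} → length xs ≡ n → drop n (xs ++ ys) ≡ ys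
drop-++-length []       ys refl = refl
drop-++-length (z ∷ xs) ys refl = drop-++-length xs ys refl

count2-++ : ∀ l (u v : Word2) → count2 l (u ++ v) ≡ count2 l u ℕ.+ count2 l v
count2-++ l [] v = refl
count2-++ x (x ∷ u) v = cong suc (count2-++ x u v)
count2-++ x (y ∷ u) v = count2-++ x u v
count2-++ y (x ∷ u) v = count2-++ y u v
count2-++ y (y ∷ u) v = cong suc (count2-++ y u v)

[m+n]-m≡n : ∀ m n → + (m ℕ.+ n) - + m ≡ + n
[m+n]-m≡n m n = begin
  + (m ℕ.+ n) - + m   ≡⟨ ℤP.m-n≡m⊖n (m ℕ.+ n) m ⟩
  (m ℕ.+ n) ⊖ m       ≡⟨ ℤP.⊖-≥ (ℕP.m≤m+n m n) ⟩
  + (m ℕ.+ n ℕ.∸ m)   ≡⟨ cong +_ (ℕP.m+n∸m≡n m n) ⟩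
  + n                 ∎
  where open ≡-Reasoning

2*n≡n+n : ∀ n → 2 ℕ.* n ≡ n ℕ.+ n
2*n≡n+n n = cong (n ℕ.+_) (ℕP.+-identityʳ n)

Even-double : ∀ m → Even (m ℕ.+ m)
Even-double ℕ.zero = ev0
Even-double (suc m) rewrite ℕP.+-suc m m = evS (odS (Even-double m))

Even-+-cancelˡ : ∀ {m n} → Even m → Even (m ℕ.+ n) → Even n
Odd-+-cancelˡ  : ∀ {m n} → Odd m → Odd (m ℕ.+ n) → Even n
Even-+-cancelˡ ev0     e        = e
Even-+-cancelˡ (evS o) (evS o′) = Odd-+-cancelˡ o o′
Odd-+-cancelˡ  (odS e) (odS e′) = Even-+-cancelˡ e e′

apply-++ : ∀ φ (u v : Word2) → apply φ (u ++ v) ≡ apply φ u ++ apply φ v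
apply-++ φ u v = trans (cong concat (map-++ (img φ) u v)) (sym (concat-++ (map (img φ) u) _))

NonErasing : Morph2 → Set
NonErasing h = ∀ l → img h l ≢ []

apply-≢[] : ∀ {φ} → NonErasing φ → ∀ {w} → w ≢ [] → apply φ w ≢ []
apply-≢[] φ↑ {[]}    w≢[] = w≢[]
apply-≢[] φ↑ {l ∷ w} _    = φ↑ l ∘ ++-conicalˡ _ _

∘ₘ-nonErasing : ∀ {φ h} → NonErasing φ → NonErasing h → NonErasing (φ ∘ₘ h)
∘ₘ-nonErasing φ↑ h↑ x = apply-≢[] φ↑ (h↑ x)
∘ₘ-nonErasing φ↑ h↑ y = apply-≢[] φ↑ (h↑ y)

sturmian-nonErasing : ∀ {h} → SpecialSturmian h → NonErasing h
sturmian-nonErasing st-id    = λ { x () ; y () }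
sturmian-nonErasing (st-G s) = ∘ₘ-nonErasing (λ { x () ; y () }) (sturmian-nonErasing s)
sturmian-nonErasing (st-G̃ s) = ∘ₘ-nonErasing (λ { x () ; y () }) (sturmian-nonErasing s)
sturmian-nonErasing (st-D s) = ∘ₘ-nonErasing (λ { x () ; y () }) (sturmian-nonErasing s)
sturmian-nonErasing (st-D̃ s) = ∘ₘ-nonErasing (λ { x () ; y () }) (sturmian-nonErasing s)

_≼_ : Word2 → Word2 → Set
u ≼ v = ∃ λ t → v ≡ u ++ t

apply-≼ : ∀ φ {u v} → u ≼ v → apply φ u ≼ apply φ v
apply-≼ φ {u} (t , refl) = apply φ t , apply-++ φ u t

≼⇒length≤ : ∀ {u v} → u ≼ v → length u ≤ length v
≼⇒length≤ {u} (t , refl) = length-++-≤ˡ u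

PrefixOrdered : Morph2 → Set
PrefixOrdered h = imgx h ≼ imgy h ⊎ imgy h ≼ imgx h

∘ₘ-prefixOrdered : ∀ φ {h} → PrefixOrdered h → PrefixOrdered (φ ∘ₘ h)
∘ₘ-prefixOrdered φ (inj₁ p) = inj₁ (apply-≼ φ p)
∘ₘ-prefixOrdered φ (inj₂ p) = inj₂ (apply-≼ φ p)

standard-prefixOrdered : ∀ {f} → SpecialStandard f → f ≡ idₘ ⊎ PrefixOrdered f
standard-prefixOrdered std-id = inj₁ refl
standard-prefixOrdered (std-G s) with standard-prefixOrdered s
... | inj₁ refl = inj₂ (inj₁ (y ∷ [] , refl))
... | inj₂ p    = inj₂ (∘ₘ-prefixOrdered Gₘ p)
standard-prefixOrdered (std-D s) with standard-prefixOrdered s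
... | inj₁ refl = inj₂ (inj₂ (x ∷ [] , refl))
... | inj₂ p    = inj₂ (∘ₘ-prefixOrdered Dₘ p)

standard-dichotomy : ∀ {f} → SpecialStandard f → imgx f ≼ imgy f ⊎ length (imgy f) ≤ length (imgx f)
standard-dichotomy s with standard-prefixOrdered s
... | inj₁ refl     = inj₂ ℕP.≤-refl
... | inj₂ (inj₁ p) = inj₁ p
... | inj₂ (inj₂ p) = inj₂ (≼⇒length≤ p)

parityAfter : Bool → Word2 → Bool
parityAfter p []      = p
parityAfter p (x ∷ w) = parityAfter p w
parityAfter p (y ∷ w) = parityAfter (not p) w

bisWord-++ : ∀ p (u v : Word2) → bisWord p (u ++ v) ≡ bisWord p u ++ bisWord (parityAfter p u) v
bisWord-++ p     []      v = refl
bisWord-++ p     (x ∷ u) v = cong (a ∷_) (bisWord-++ p u v)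
bisWord-++ false (y ∷ u) v = cong (b ∷_) (bisWord-++ true u v)
bisWord-++ true  (y ∷ u) v = cong (c ∷_) (bisWord-++ false u v)

length-bisWord : ∀ p (w : Word2) → length (bisWord p w) ≡ length w
length-bisWord p     []      = refl
length-bisWord p     (x ∷ w) = cong suc (length-bisWord p w)
length-bisWord false (y ∷ w) = cong suc (length-bisWord true w)
length-bisWord true  (y ∷ w) = cong suc (length-bisWord false w)

bisect-prefix : ∀ u t → let σ = bisect (mk u (u ++ t)) in
  σ a ++ σ b ≡ bisWord false (u ++ u) × ∃ λ q → σ c ≡ bisWord q t
bisect-prefix u t = trans (cong₂ _++_ σa σb) (sym (bisWord-++ false u u)) , parityAfter p₁ u , σc
  where
  σ = bisect (mk u (u ++ t))
  m = length u
  p₁ = parityAfter false u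
  whole : bisWord false (u ++ u ++ t) ≡ bisWord false u ++ bisWord p₁ u ++ bisWord (parityAfter p₁ u) t
  whole = trans (bisWord-++ false u (u ++ t)) (cong (bisWord false u ++_) (bisWord-++ p₁ u t))
  rest : drop m (bisWord false (u ++ u ++ t)) ≡ bisWord p₁ u ++ bisWord (parityAfter p₁ u) t
  rest = trans (cong (drop m) whole) (drop-++-length (bisWord false u) _ (length-bisWord false u))
  σa : σ a ≡ bisWord false u
  σa = trans (cong (take m) whole) (take-++-length (bisWord false u) _ (length-bisWord false u))
  σb : σ b ≡ bisWord p₁ u
  σb = trans (cong (take m) rest) (take-++-length (bisWord p₁ u) _ (length-bisWord p₁ u))
  σc : σ c ≡ bisWord (parityAfter p₁ u) t
  σc = trans (sym (drop-drop m m _)) (trans (cong (drop m) rest) (drop-++-length (bisWord p₁ u) _ (length-bisWord p₁ u)))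

bisect-c≡[] : ∀ f → length (imgy f) ≤ length (imgx f) → bisect f c ≡ []
bisect-c≡[] f |c|≤|a| = drop-all (m ℕ.+ m) _ (begin
  length (bisWord false (imgx f ++ imgy f)) ≡⟨ length-bisWord false (imgx f ++ imgy f) ⟩
  length (imgx f ++ imgy f)                 ≡⟨ length-++ (imgx f) ⟩
  m ℕ.+ length (imgy f)                     ≤⟨ ℕP.+-monoʳ-≤ m |c|≤|a| ⟩
  m ℕ.+ m                                   ∎)
  where open ℕP.≤-Reasoning
        m = length (imgx f)

count3 : L3 → Word3 → ℕ
count3 _ []      = 0
count3 a (a ∷ s) = suc (count3 a s)
count3 a (b ∷ s) = count3 a s
count3 a (c ∷ s) = count3 a s
count3 b (a ∷ s) = count3 b s
count3 b (b ∷ s) = suc (count3 b s)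
count3 b (c ∷ s) = count3 b s
count3 c (a ∷ s) = count3 c s
count3 c (b ∷ s) = count3 c s
count3 c (c ∷ s) = suc (count3 c s)

count2-x-map-pAB : ∀ s → count2 x (map pAB s) ≡ count3 a s ℕ.+ count3 b s
count2-x-map-pAB []      = refl
count2-x-map-pAB (a ∷ s) = cong suc (count2-x-map-pAB s)
count2-x-map-pAB (b ∷ s) = trans (cong suc (count2-x-map-pAB s)) (sym (ℕP.+-suc (count3 a s) _))
count2-x-map-pAB (c ∷ s) = count2-x-map-pAB s

count2-y-map-pAB : ∀ s → count2 y (map pAB s) ≡ count3 c s
count2-y-map-pAB []      = refl
count2-y-map-pAB (a ∷ s) = count2-y-map-pAB s
count2-y-map-pAB (b ∷ s) = count2-y-map-pAB s
count2-y-map-pAB (c ∷ s) = cong suc (count2-y-map-pAB s)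

count2-x-map-pCA : ∀ s → count2 x (map pCA s) ≡ count3 a s ℕ.+ count3 c s
count2-x-map-pCA []      = refl
count2-x-map-pCA (a ∷ s) = cong suc (count2-x-map-pCA s)
count2-x-map-pCA (b ∷ s) = count2-x-map-pCA s
count2-x-map-pCA (c ∷ s) = trans (cong suc (count2-x-map-pCA s)) (sym (ℕP.+-suc (count3 a s) _))

count2-y-map-pCA : ∀ s → count2 y (map pCA s) ≡ count3 b s
count2-y-map-pCA []      = refl
count2-y-map-pCA (a ∷ s) = count2-y-map-pCA s
count2-y-map-pCA (b ∷ s) = cong suc (count2-y-map-pCA s)
count2-y-map-pCA (c ∷ s) = count2-y-map-pCA s

Balanced : Word3 → Set
Balanced s = count3 b s ≡ count3 c s

-- π_{a→b} and π_{c→a} differ only in which of b, c they merge with a.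
incidence-projAB≡projCA : ∀ σ → Balanced (σ a ++ σ b) → Balanced (σ c)
  → incidence (projAB σ) ≡ incidence (projCA σ)
incidence-projAB≡projCA σ bal-ab bal-c =
  cong₄ mat (swap-x (σ a ++ σ b) bal-ab) (swap-x (σ c) bal-c) (swap-y (σ a ++ σ b) bal-ab) (swap-y (σ c) bal-c)
  where
  swap-x : ∀ s → Balanced s → count2 x (map pAB s) ≡ count2 x (map pCA s)
  swap-x s bal = trans (count2-x-map-pAB s) (trans (cong (count3 a s ℕ.+_) bal) (sym (count2-x-map-pCA s)))
  swap-y : ∀ s → Balanced s → count2 y (map pAB s) ≡ count2 y (map pCA s)
  swap-y s bal = trans (count2-y-map-pAB s) (trans (sym bal) (sym (count2-y-map-pCA s)))
  cong₄ : ∀ (g : ℕ → ℕ → ℕ → ℕ → Mat2) {p q r s p′ q′ r′ s′}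
    → p ≡ p′ → q ≡ q′ → r ≡ r′ → s ≡ s′ → g p q r s ≡ g p′ q′ r′ s′
  cong₄ g refl refl refl refl = refl

count3-a-bisWord : ∀ p w → count3 a (bisWord p w) ≡ count2 x w
count3-a-bisWord p     []      = refl
count3-a-bisWord p     (x ∷ w) = cong suc (count3-a-bisWord p w)
count3-a-bisWord false (y ∷ w) = count3-a-bisWord true w
count3-a-bisWord true  (y ∷ w) = count3-a-bisWord false w

count3-bc-bisWord : ∀ p w → count3 b (bisWord p w) ℕ.+ count3 c (bisWord p w) ≡ count2 y w
count3-bc-bisWord p     []      = refl
count3-bc-bisWord p     (x ∷ w) = count3-bc-bisWord p w
count3-bc-bisWord false (y ∷ w) = cong suc (count3-bc-bisWord true w)
count3-bc-bisWord true  (y ∷ w) = trans (ℕP.+-suc (count3 b (bisWord false w)) _) (cong suc (count3-bc-bisWord false w))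

-- With parity flag p, the next c of the input becomes nextLetter p.
nextLetter otherLetter : Bool → L3
nextLetter false = b
nextLetter true  = c
otherLetter false = c
otherLetter true  = b

bisWord-balanced : ∀ p w → Even (count2 y w) → Balanced (bisWord p w)
bisWord-unbalanced : ∀ p w → Odd (count2 y w)
  → count3 (nextLetter p) (bisWord p w) ≡ suc (count3 (otherLetter p) (bisWord p w))
bisWord-balanced p     []      _       = refl
bisWord-balanced p     (x ∷ w) e       = bisWord-balanced p w e
bisWord-balanced false (y ∷ w) (evS o) = sym (bisWord-unbalanced true w o)
bisWord-balanced true  (y ∷ w) (evS o) = bisWord-unbalanced false w o
bisWord-unbalanced false (x ∷ w) o       = bisWord-unbalanced false w o
bisWord-unbalanced true  (x ∷ w) o       = bisWord-unbalanced true w o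
bisWord-unbalanced false (y ∷ w) (odS e) = cong suc (bisWord-balanced true w e)
bisWord-unbalanced true  (y ∷ w) (odS e) = cong suc (sym (bisWord-balanced false w e))

2*count3-c-bisWord : ∀ p w → Even (count2 y w) → 2 ℕ.* count3 c (bisWord p w) ≡ count2 y w
2*count3-c-bisWord p w e = begin
  2 ℕ.* C    ≡⟨ 2*n≡n+n C ⟩
  C ℕ.+ C    ≡⟨ cong (ℕ._+ C) (sym (bisWord-balanced p w e)) ⟩
  B ℕ.+ C    ≡⟨ count3-bc-bisWord p w ⟩
  count2 y w ∎
  where open ≡-Reasoning
        B = count3 b (bisWord p w)
        C = count3 c (bisWord p w)

2*count2-x-map-pAB-bisWord : ∀ p w → Even (count2 y w)
  → 2 ℕ.* count2 x (map pAB (bisWord p w)) ≡ 2 ℕ.* count2 x w ℕ.+ count2 y w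
2*count2-x-map-pAB-bisWord p w e = begin
  2 ℕ.* count2 x (map pAB s)            ≡⟨ cong (2 ℕ.*_) (count2-x-map-pAB s) ⟩
  2 ℕ.* (count3 a s ℕ.+ count3 b s)     ≡⟨ ℕP.*-distribˡ-+ 2 (count3 a s) _ ⟩
  2 ℕ.* count3 a s ℕ.+ 2 ℕ.* count3 b s ≡⟨ cong₂ (λ m n → 2 ℕ.* m ℕ.+ 2 ℕ.* n) (count3-a-bisWord p w) (bisWord-balanced p w e) ⟩
  2 ℕ.* count2 x w ℕ.+ 2 ℕ.* count3 c s ≡⟨ cong (2 ℕ.* count2 x w ℕ.+_) (2*count3-c-bisWord p w e) ⟩
  2 ℕ.* count2 x w ℕ.+ count2 y w       ∎
  where open ≡-Reasoning
        s = bisWord p w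

2*count2-y-map-pAB-bisWord : ∀ p w → Even (count2 y w) → 2 ℕ.* count2 y (map pAB (bisWord p w)) ≡ count2 y w
2*count2-y-map-pAB-bisWord p w e = trans (cong (2 ℕ.*_) (count2-y-map-pAB (bisWord p w))) (2*count3-c-bisWord p w e)

incidence-projAB-bisected : ∀ σ u t {q} → σ a ++ σ b ≡ bisWord false (u ++ u) → σ c ≡ bisWord q t
  → Even (count2 y t) → let M = incidence (projAB σ) in
  M ≡ incidence (projCA σ)
  × m11 M ≡ 2 ℕ.* count2 x u ℕ.+ count2 y u
  × 2 ℕ.* m12 M ≡ 2 ℕ.* count2 x t ℕ.+ count2 y t
  × m21 M ≡ count2 y u
  × 2 ℕ.* m22 M ≡ count2 y t
incidence-projAB-bisected σ u t {q} σab σc even-t =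
  incidence-projAB≡projCA σ (at-ab Balanced (bisWord-balanced false (u ++ u) even-uu))
                            (at-c Balanced (bisWord-balanced q t even-t)) ,
  at-ab (λ s → count2 x (map pAB s) ≡ 2 ℕ.* ux ℕ.+ uy) m11≡ ,
  at-c (λ s → 2 ℕ.* count2 x (map pAB s) ≡ 2 ℕ.* count2 x t ℕ.+ count2 y t) (2*count2-x-map-pAB-bisWord q t even-t) ,
  at-ab (λ s → count2 y (map pAB s) ≡ uy) m21≡ ,
  at-c (λ s → 2 ℕ.* count2 y (map pAB s) ≡ count2 y t) (2*count2-y-map-pAB-bisWord q t even-t)
  where
  open ≡-Reasoning
  ux = count2 x u
  uy = count2 y u
  S = bisWord false (u ++ u)
  at-ab : (P : Word3 → Set) → P S → P (σ a ++ σ b)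
  at-ab P = subst P (sym σab)
  at-c : (P : Word3 → Set) → P (bisWord q t) → P (σ c)
  at-c P = subst P (sym σc)
  even-uu : Even (count2 y (u ++ u))
  even-uu rewrite count2-++ y u u = Even-double uy
  regroup : ∀ m n → 2 ℕ.* (m ℕ.+ m) ℕ.+ (n ℕ.+ n) ≡ 2 ℕ.* (2 ℕ.* m ℕ.+ n)
  regroup = solve-∀
  m11≡ : count2 x (map pAB S) ≡ 2 ℕ.* ux ℕ.+ uy
  m11≡ = ℕP.*-cancelˡ-≡ _ _ 2 (begin
    2 ℕ.* count2 x (map pAB S)                      ≡⟨ 2*count2-x-map-pAB-bisWord false (u ++ u) even-uu ⟩
    2 ℕ.* count2 x (u ++ u) ℕ.+ count2 y (u ++ u)   ≡⟨ cong₂ (λ m n → 2 ℕ.* m ℕ.+ n) (count2-++ x u u) (count2-++ y u u) ⟩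
    2 ℕ.* (ux ℕ.+ ux) ℕ.+ (uy ℕ.+ uy)               ≡⟨ regroup ux uy ⟩
    2 ℕ.* (2 ℕ.* ux ℕ.+ uy)                         ∎)
  m21≡ : count2 y (map pAB S) ≡ uy
  m21≡ = ℕP.*-cancelˡ-≡ _ _ 2 (begin
    2 ℕ.* count2 y (map pAB S) ≡⟨ 2*count2-y-map-pAB-bisWord false (u ++ u) even-uu ⟩
    count2 y (u ++ u)          ≡⟨ count2-++ y u u ⟩
    uy ℕ.+ uy                  ≡⟨ 2*n≡n+n uy ⟨
    2 ℕ.* uy                   ∎)

+[2*m+n] : ∀ m n → + (2 ℕ.* m ℕ.+ n) ≡ + 2 * + m + + n
+[2*m+n] m n = trans (ℤP.pos-+ (2 ℕ.* m) n) (cong (_+ + n) (ℤP.pos-* 2 m))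

count2-++-minus : ∀ l u v → + count2 l (u ++ v) - + count2 l u ≡ + count2 l v
count2-++-minus l u v = trans (cong (λ n → + n - + count2 l u) (count2-++ l u v)) ([m+n]-m≡n (count2 l u) (count2 l v))

Even-count2-++-double : ∀ l u v → Even (count2 l (u ++ u ++ v)) → Even (count2 l v)
Even-count2-++-double l u v e rewrite count2-++ l u (u ++ v) | count2-++ l u v
  | sym (ℕP.+-assoc (count2 l u) (count2 l u) (count2 l v)) = Even-+-cancelˡ (Even-double (count2 l u)) e

IncidenceFormula : Morph2 → Set
IncidenceFormula f = let M = incidence (projAB (bisect f)) in
  M ≡ incidence (projCA (bisect f))
  × (+ m11 M ≡ + 2 * + count2 x (imgx f) + + count2 y (imgx f))
  × (+ 2 * + m12 M ≡ + 2 * (+ count2 x (imgy f) - + count2 x (imgx f)) + (+ count2 y (imgy f) - + count2 y (imgx f)))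
  × (+ m21 M ≡ + count2 y (imgx f))
  × (+ 2 * + m22 M ≡ + count2 y (imgy f) - + count2 y (imgx f))

incidenceFormula-prefix : ∀ u t → Even (count2 y (u ++ u ++ t)) → IncidenceFormula (mk u (u ++ t))
incidenceFormula-prefix u t even-uut
  with σab , _ , σc ← bisect-prefix u t
  with M≡ , m11≡ , 2m12≡ , m21≡ , 2m22≡
         ← incidence-projAB-bisected (bisect (mk u (u ++ t))) u t σab σc (Even-count2-++-double y u t even-uut) =
  M≡ ,
  trans (cong +_ m11≡) (+[2*m+n] (count2 x u) (count2 y u)) ,
  (begin
    + 2 * + m12 M                         ≡⟨ ℤP.pos-* 2 (m12 M) ⟨
    + (2 ℕ.* m12 M)                       ≡⟨ cong +_ 2m12≡ ⟩
    + (2 ℕ.* count2 x t ℕ.+ count2 y t)   ≡⟨ +[2*m+n] (count2 x t) (count2 y t) ⟩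
    + 2 * + count2 x t + + count2 y t     ≡⟨ cong₂ (λ i j → + 2 * i + j) (count2-++-minus x u t) (count2-++-minus y u t) ⟨
    + 2 * (+ count2 x (u ++ t) - + count2 x u) + (+ count2 y (u ++ t) - + count2 y u) ∎) ,
  cong +_ m21≡ ,
  trans (sym (ℤP.pos-* 2 (m22 M))) (trans (cong +_ 2m22≡) (sym (count2-++-minus y u t)))
  where
  open ≡-Reasoning
  M = incidence (projAB (bisect (mk u (u ++ t))))

proposition2 : (f : Morph2) → SpecialStandard f
    → Odd (length (imgx f ++ imgy f))
    → Even (count2 y (imgx f ++ imgy f))
    → AuthenticPWWF (bisect f)
    → incidence (projAB (bisect f)) ≡ incidence (projCA (bisect f))
    × (+ m11 (incidence (projAB (bisect f))) ≡ + 2 * + count2 x (imgx f) + + count2 y (imgx f))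
    × (+ 2 * + m12 (incidence (projAB (bisect f)))
    ≡ + 2 * (+ count2 x (imgy f) - + count2 x (imgx f)) + (+ count2 y (imgy f) - + count2 y (imgx f)))
    × (+ m21 (incidence (projAB (bisect f))) ≡ + count2 y (imgx f))
    × (+ 2 * + m22 (incidence (projAB (bisect f))) ≡ + count2 y (imgy f) - + count2 y (imgx f))
proposition2 (mk u v) standard _ even (_ , sturmian-AB , _) with standard-dichotomy standard
... | inj₁ (t , refl) = incidenceFormula-prefix u t even
... | inj₂ |v|≤|u|    =
  ⊥-elim (sturmian-nonErasing sturmian-AB y (cong (map pAB) (bisect-c≡[] (mk u v) |v|≤|u|)))
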